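{- Let $p$ be a prime. If $x\equiv a^p\pmod{p^2}$ and $y\equiv b^p\pmod{p^2}$ are $p$th powers modulo $p^2$ with $y-x\equiv\pm1\pmod{p^2}$, then $b-a\equiv\pm1\pmod p$ (with the same sign); that is, consecutive $p$th powers modulo $p^2$ are $p$th powers of consecutive residue classes modulo $p$. -}

module Defs where

open import Data.Nat.Base using (ℕ)
open import Data.Integer.Base using (ℤ; _-_; +_)
open import Data.Integer.Divisibility using (_∣_)

infix 4 _≡_[mod_]
_≡_[mod_] : ℤ → ℤ → ℕ → Set
u ≡ v [mod m ] = (+ m) ∣ (u - v)

-- Modulo p the hypotheses give b^p - a^p ≡ y - x ≡ s, and by Fermat's little theorem
-- b^p - a^p ≡ b - a. Fermat's theorem follows by
-- induction on a from (1 + a)^p ≡ 1 + a^p (mod p), an instance of the binomial theorem in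
-- which p divides every inner coefficient C(p,k), because k·C(p,k) = p·C(p-1,k-1).
module Submission where

open import Defs
open import Data.Nat.Base using (ℕ) renaming (_^_ to _^ℕ_)
open import Data.Nat.Primality using (Prime)
open import Data.Integer.Base using (ℤ; _-_; _^_; -_; +_)
open import Data.Sum.Base using (_⊎_)
open import Relation.Binary.PropositionalEquality using () renaming (_≡_ to _≡ₚ_)

open import Data.Fin.Base using (zero; suc; toℕ; fromℕ; inject₁)
open import Data.Fin.Properties using (toℕ<n; toℕ-inject₁; toℕ-fromℕ)
open import Data.Integer.Base as ℤ using (_+_; _*_; 0ℤ; 1ℤ; -[1+_])
import Data.Integer.Divisibility.Signed as ℤ∣
import Data.Integer.Properties as ℤ
open import Data.Integer.Tactic.RingSolver using (solve-∀)
open import Data.Nat.Base as ℕ using (zero; suc; z<s; s<s)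
open import Data.Nat.Combinatorics using (_C_; nCn≡1; nC1≡n; nCk+nC[k+1]≡[n+1]C[k+1]; k>n⇒nCk≡0)
import Data.Nat.Divisibility as ℕ∣
open import Data.Nat.Primality using (euclidsLemma)
import Data.Nat.Properties as ℕ
open import Data.Nat.Tactic.RingSolver using () renaming (solve-∀ to ℕ-solve-∀)
open import Data.Sum.Base using (inj₁; inj₂)
open import Data.Vec.Functional using (Vector; head; last; init; tail)
open import Level using (0ℓ)
open import Relation.Binary.Bundles using (Setoid)
import Relation.Binary.Reasoning.Setoid as SetoidReasoning
open import Relation.Binary.PropositionalEquality as ≡ using (refl; cong; cong₂)
open import Relation.Nullary.Negation using (contradiction)

open import Algebra.Properties.CommutativeSemiring.Binomial ℤ.+-*-commutativeSemiring
  using (theorem; binomialTerm)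
open import Algebra.Properties.Semiring.Exp ℤ.+-*-semiring using () renaming (_^_ to _^ₛ_)
open import Algebra.Properties.Semiring.Mult ℤ.+-*-semiring using (_×_)
open import Algebra.Properties.Semiring.Sum ℤ.+-*-semiring using (sum; sum-init-last)

[k+1]*[n+1]C[k+1]≡[n+1]*nCk : ∀ n k → suc k ℕ.* (suc n C suc k) ≡ₚ suc n ℕ.* (n C k)
[k+1]*[n+1]C[k+1]≡[n+1]*nCk zero zero = refl
[k+1]*[n+1]C[k+1]≡[n+1]*nCk zero (suc k) = begin
  suc (suc k) ℕ.* (1 C suc (suc k))  ≡⟨ cong (suc (suc k) ℕ.*_) (k>n⇒nCk≡0 (s<s (z<s {k}))) ⟩
  suc (suc k) ℕ.* 0                  ≡⟨ ℕ.*-zeroʳ (suc (suc k)) ⟩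
  0                                  ≡⟨ cong (1 ℕ.*_) (k>n⇒nCk≡0 (z<s {k})) ⟨
  1 ℕ.* (0 C suc k)                  ∎
  where open ≡.≡-Reasoning
[k+1]*[n+1]C[k+1]≡[n+1]*nCk (suc n) zero = begin
  1 ℕ.* (suc (suc n) C 1)  ≡⟨ ℕ.*-identityˡ _ ⟩
  suc (suc n) C 1          ≡⟨ nC1≡n (suc (suc n)) ⟩
  suc (suc n)              ≡⟨ ℕ.*-identityʳ _ ⟨
  suc (suc n) ℕ.* 1        ∎
  where open ≡.≡-Reasoning
[k+1]*[n+1]C[k+1]≡[n+1]*nCk (suc n) (suc k) = begin
  suc (suc k) ℕ.* (suc (suc n) C suc (suc k))
    ≡⟨ cong (suc (suc k) ℕ.*_) (nCk+nC[k+1]≡[n+1]C[k+1] (suc n) (suc k)) ⟨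
  suc (suc k) ℕ.* (A ℕ.+ B)
    ≡⟨ regroup (suc k) A B ⟩
  A ℕ.+ (suc k ℕ.* A ℕ.+ suc (suc k) ℕ.* B)
    ≡⟨ cong (A ℕ.+_) (cong₂ ℕ._+_ ([k+1]*[n+1]C[k+1]≡[n+1]*nCk n k)
                                  ([k+1]*[n+1]C[k+1]≡[n+1]*nCk n (suc k))) ⟩
  A ℕ.+ (suc n ℕ.* (n C k) ℕ.+ suc n ℕ.* (n C suc k))
    ≡⟨ cong (A ℕ.+_) (ℕ.*-distribˡ-+ (suc n) (n C k) (n C suc k)) ⟨
  A ℕ.+ suc n ℕ.* (n C k ℕ.+ n C suc k)
    ≡⟨ cong (λ c → A ℕ.+ suc n ℕ.* c) (nCk+nC[k+1]≡[n+1]C[k+1] n k) ⟩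
  suc (suc n) ℕ.* A
    ∎
  where
  open ≡.≡-Reasoning
  A = suc n C suc k
  B = suc n C suc (suc k)
  regroup : ∀ j u v → suc j ℕ.* (u ℕ.+ v) ≡ₚ u ℕ.+ (j ℕ.* u ℕ.+ suc j ℕ.* v)
  regroup = ℕ-solve-∀

p∣pCk : ∀ {p k} → Prime p → 0 ℕ.< k → k ℕ.< p → p ℕ∣.∣ p C k
p∣pCk {suc n} {suc k} prime-p _ k<p
  with euclidsLemma (suc k) (suc n C suc k) prime-p
         (≡.subst (suc n ℕ∣.∣_) (≡.sym ([k+1]*[n+1]C[k+1]≡[n+1]*nCk n k)) (ℕ∣.m∣m*n (n C k)))
... | inj₁ p∣k+1 = contradiction (ℕ∣.∣⇒≤ p∣k+1) (ℕ.<⇒≱ k<p)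
... | inj₂ p∣pCk = p∣pCk

^ₛ≡^ : ∀ x n → x ^ₛ n ≡ₚ x ^ n
^ₛ≡^ x zero = refl
^ₛ≡^ x (suc n) = cong (x *_) (^ₛ≡^ x n)

×≡* : ∀ n x → n × x ≡ₚ + n * x
×≡* zero x = ≡.sym (ℤ.*-zeroˡ x)
×≡* (suc n) x = ≡.trans (cong (_+_ x) (×≡* n x)) (≡.sym (ℤ.suc-* (+ n) x))

∣sum : ∀ {d n} (t : Vector ℤ n) → (∀ i → d ℤ∣.∣ t i) → d ℤ∣.∣ sum t
∣sum {n = zero} t d∣t = ℤ∣.divides 0ℤ refl
∣sum {n = suc n} t d∣t = ℤ∣.∣m∣n⇒∣m+n (d∣t zero) (∣sum (tail t) (λ i → d∣t (suc i)))

∣sum-inner : ∀ {d n} (t : Vector ℤ (suc (suc n))) → (∀ i → d ℤ∣.∣ t (suc (inject₁ i))) →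
             d ℤ∣.∣ sum t - (head t + last t)
∣sum-inner t d∣t = ≡.subst (_ ℤ∣.∣_) inner≡ (∣sum (init (tail t)) d∣t)
  where
  cancel : ∀ h m l → m ≡ₚ (h + (m + l)) - (h + l)
  cancel = solve-∀

  inner≡ : sum (init (tail t)) ≡ₚ sum t - (head t + last t)
  inner≡ = ≡.trans (cancel (head t) _ (last t))
    (cong (λ s → (head t + s) - (head t + last t)) (≡.sym (sum-init-last (tail t))))

-- _≡_[mod_] restated with signed divisibility inside a record, so that Agda can infer
-- both sides of a congruence from a proof of it.
infix 4 _≋_[mod_]
record _≋_[mod_] (u v : ℤ) (m : ℕ) : Set where
  constructor mk≋
  field divides : + m ℤ∣.∣ u - v

open _≋_[mod_]

module _ {m : ℕ} where

  private
    along : ∀ {i j} → i ≡ₚ j → + m ℤ∣.∣ i → + m ℤ∣.∣ j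
    along i≡j = ≡.subst (+ m ℤ∣.∣_) i≡j

  ≡-mod⇒≋ : ∀ {u v} → u ≡ v [mod m ] → u ≋ v [mod m ]
  ≡-mod⇒≋ u≡v = mk≋ (ℤ∣.∣ᵤ⇒∣ u≡v)

  ≋⇒≡-mod : ∀ {u v} → u ≋ v [mod m ] → u ≡ v [mod m ]
  ≋⇒≡-mod u≋v = ℤ∣.∣⇒∣ᵤ (divides u≋v)

  ≋-reflexive : ∀ {u v} → u ≡ₚ v → u ≋ v [mod m ]
  ≋-reflexive {u} refl = mk≋ (along (≡.sym (ℤ.+-inverseʳ u)) (ℤ∣.divides 0ℤ refl))

  ≋-refl : ∀ {u} → u ≋ u [mod m ]
  ≋-refl = ≋-reflexive refl

  ≋-sym : ∀ {u v} → u ≋ v [mod m ] → v ≋ u [mod m ]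
  ≋-sym {u} {v} (mk≋ m∣u-v) = mk≋ (along (flip u v) (ℤ∣.∣m⇒∣-m m∣u-v))
    where
    flip : ∀ u v → - (u - v) ≡ₚ v - u
    flip = solve-∀

  ≋-trans : ∀ {u v w} → u ≋ v [mod m ] → v ≋ w [mod m ] → u ≋ w [mod m ]
  ≋-trans {u} {v} {w} (mk≋ m∣u-v) (mk≋ m∣v-w) =
    mk≋ (along (telescope u v w) (ℤ∣.∣m∣n⇒∣m+n m∣u-v m∣v-w))
    where
    telescope : ∀ u v w → (u - v) + (v - w) ≡ₚ u - w
    telescope = solve-∀

  +-congˡ-≋ : ∀ w {u v} → u ≋ v [mod m ] → w + u ≋ w + v [mod m ]
  +-congˡ-≋ w {u} {v} (mk≋ m∣u-v) = mk≋ (along (≡.sym (cancel w u v)) m∣u-v)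
    where
    cancel : ∀ w u v → (w + u) - (w + v) ≡ₚ u - v
    cancel = solve-∀

  minus-cong-≋ : ∀ {u u′ v v′} → u ≋ u′ [mod m ] → v ≋ v′ [mod m ] → u - v ≋ u′ - v′ [mod m ]
  minus-cong-≋ {u} {u′} {v} {v′} (mk≋ m∣u-u′) (mk≋ m∣v-v′) =
    mk≋ (along (regroup u u′ v v′) (ℤ∣.∣m∣n⇒∣m-n m∣u-u′ m∣v-v′))
    where
    regroup : ∀ u u′ v v′ → (u - u′) - (v - v′) ≡ₚ (u - v) - (u′ - v′)
    regroup = solve-∀

  +-cancelˡ-≋ : ∀ w {u v} → w + u ≋ w + v [mod m ] → u ≋ v [mod m ]
  +-cancelˡ-≋ w {u} {v} (mk≋ m∣w+u-w+v) = mk≋ (along (cancel w u v) m∣w+u-w+v)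
    where
    cancel : ∀ w u v → (w + u) - (w + v) ≡ₚ u - v
    cancel = solve-∀

≋-weaken : ∀ {d n u v} → d ℕ∣.∣ n → u ≋ v [mod n ] → u ≋ v [mod d ]
≋-weaken {d} {n} d∣n (mk≋ n∣u-v) = mk≋ (ℤ∣.∣-trans (ℤ∣.∣ᵤ⇒∣ {+ d} {+ n} d∣n) n∣u-v)

≋-setoid : ℕ → Setoid 0ℓ 0ℓ
≋-setoid m = record
  { Carrier       = ℤ
  ; _≈_           = _≋_[mod m ]
  ; isEquivalence = record { refl = ≋-refl ; sym = ≋-sym ; trans = ≋-trans }
  }

module ≋-Reasoning (m : ℕ) = SetoidReasoning (≋-setoid m)

∣m⇒∣m×x : ∀ {d c} x → d ℕ∣.∣ c → + d ℤ∣.∣ c × x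
∣m⇒∣m×x {d} {c} x d∣c =
  ≡.subst (+ d ℤ∣.∣_) (≡.sym (×≡* c x)) (ℤ∣.∣m⇒∣m*n x (ℤ∣.∣ᵤ⇒∣ {+ d} {+ c} d∣c))

[x+y]^p≋x^p+y^p : ∀ {p} → Prime p → ∀ x y → (x + y) ^ p ≋ x ^ p + y ^ p [mod p ]
[x+y]^p≋x^p+y^p {zero} ()
[x+y]^p≋x^p+y^p {p@(suc n)} prime-p x y =
  mk≋ (≡.subst (+ p ℤ∣.∣_) expansion (∣sum-inner t p∣middle))
  where
  open ≡.≡-Reasoning
  t : Vector ℤ (suc p)
  t = binomialTerm x y p

  p∣middle : ∀ i → + p ℤ∣.∣ t (suc (inject₁ i))
  p∣middle i = ∣m⇒∣m×x _ (p∣pCk prime-p z<s (s<s k<n))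
    where
    k<n : toℕ (inject₁ i) ℕ.< n
    k<n = ≡.subst (ℕ._< n) (≡.sym (toℕ-inject₁ i)) (toℕ<n i)

  head≡ : head t ≡ₚ y ^ p
  head≡ = begin
    1ℤ * y ^ₛ p + 0ℤ  ≡⟨ ℤ.+-identityʳ _ ⟩
    1ℤ * y ^ₛ p       ≡⟨ ℤ.*-identityˡ _ ⟩
    y ^ₛ p            ≡⟨ ^ₛ≡^ y p ⟩
    y ^ p             ∎

  last≡ : last t ≡ₚ x ^ p
  last≡ = begin
    (p C toℕ (fromℕ p)) × (x ^ₛ toℕ (fromℕ p) * y ^ₛ (p ℕ.∸ toℕ (fromℕ p)))
      ≡⟨ cong (λ k → (p C k) × (x ^ₛ k * y ^ₛ (p ℕ.∸ k))) (toℕ-fromℕ p) ⟩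
    (p C p) × (x ^ₛ p * y ^ₛ (p ℕ.∸ p))
      ≡⟨ cong₂ (λ c e → c × (x ^ₛ p * y ^ₛ e)) (nCn≡1 p) (ℕ.n∸n≡0 p) ⟩
    x ^ₛ p * 1ℤ + 0ℤ
      ≡⟨ ℤ.+-identityʳ _ ⟩
    x ^ₛ p * 1ℤ
      ≡⟨ ℤ.*-identityʳ _ ⟩
    x ^ₛ p
      ≡⟨ ^ₛ≡^ x p ⟩
    x ^ p
      ∎

  expansion : sum t - (head t + last t) ≡ₚ (x + y) ^ p - (x ^ p + y ^ p)
  expansion = cong₂ _-_
    (≡.trans (≡.sym (theorem p x y)) (^ₛ≡^ (x + y) p))
    (≡.trans (cong₂ _+_ head≡ last≡) (ℤ.+-comm (y ^ p) (x ^ p)))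

[1+a]^p≋1+a^p : ∀ {p} → Prime p → ∀ a → (1ℤ + a) ^ p ≋ 1ℤ + a ^ p [mod p ]
[1+a]^p≋1+a^p {p} prime-p a = ≋-trans ([x+y]^p≋x^p+y^p prime-p 1ℤ a)
  (≋-reflexive (cong (_+ a ^ p) (ℤ.^-zeroˡ p)))

fermat's-little-theorem : ∀ {p} → Prime p → ∀ a → a ^ p ≋ a [mod p ]
fermat's-little-theorem {zero} ()
fermat's-little-theorem {p@(suc n)} prime-p = go
  where
  open ≋-Reasoning p

  succ : ∀ a → a ^ p ≋ a [mod p ] → (1ℤ + a) ^ p ≋ 1ℤ + a [mod p ]
  succ a aᵖ≋a = begin
    (1ℤ + a) ^ p  ≈⟨ [1+a]^p≋1+a^p prime-p a ⟩
    1ℤ + a ^ p    ≈⟨ +-congˡ-≋ 1ℤ aᵖ≋a ⟩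
    1ℤ + a        ∎

  pred : ∀ a → (1ℤ + a) ^ p ≋ 1ℤ + a [mod p ] → a ^ p ≋ a [mod p ]
  pred a [1+a]ᵖ≋1+a = +-cancelˡ-≋ 1ℤ (begin
    1ℤ + a ^ p    ≈⟨ [1+a]^p≋1+a^p prime-p a ⟨
    (1ℤ + a) ^ p  ≈⟨ [1+a]ᵖ≋1+a ⟩
    1ℤ + a        ∎)

  go : ∀ a → a ^ p ≋ a [mod p ]
  go (+ zero)      = ≋-reflexive (ℤ.*-zeroˡ (0ℤ ^ n))
  go (+ suc m)     = succ (+ m) (go (+ m))
  go -[1+ zero ]   = pred -[1+ zero ] (go (+ zero))
  go -[1+ suc m ]  = pred -[1+ suc m ] (go -[1+ m ])

lemma2p4 : (p : ℕ) → Prime p → (a b x y s : ℤ) → (s ≡ₚ + 1 ⊎ s ≡ₚ - (+ 1)) →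
    x ≡ a ^ p [mod p ^ℕ 2 ] → y ≡ b ^ p [mod p ^ℕ 2 ] →
    y - x ≡ s [mod p ^ℕ 2 ] → b - a ≡ s [mod p ]
lemma2p4 p prime-p a b x y s _ x≡aᵖ y≡bᵖ y-x≡s = ≋⇒≡-mod (begin
  b - a          ≈⟨ minus-cong-≋ (fermat b) (fermat a) ⟨
  b ^ p - a ^ p  ≈⟨ ≋-weaken p∣p² (minus-cong-≋ y≋bᵖ x≋aᵖ) ⟨
  y - x          ≈⟨ ≋-weaken p∣p² y-x≋s ⟩
  s              ∎)
  where
  open ≋-Reasoning p

  fermat : ∀ c → c ^ p ≋ c [mod p ]
  fermat = fermat's-little-theorem prime-p

  p∣p² : p ℕ∣.∣ p ^ℕ 2
  p∣p² = ℕ∣.m∣m*n (p ^ℕ 1)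

  x≋aᵖ : x ≋ a ^ p [mod p ^ℕ 2 ]
  x≋aᵖ = ≡-mod⇒≋ x≡aᵖ

  y≋bᵖ : y ≋ b ^ p [mod p ^ℕ 2 ]
  y≋bᵖ = ≡-mod⇒≋ y≡bᵖ

  y-x≋s : y - x ≋ s [mod p ^ℕ 2 ]
  y-x≋s = ≡-mod⇒≋ y-x≡s
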